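{- For positive integers $k<d$, the graph $G(k,d)$ has $\binom{d-1}{k}+1$ vertices. Furthermore, $G(k,d)_{[d]\setminus\{c\}}$ is connected for each $c\in[d]$.
   Context: $W_d$ is the set of words of length $d$ over $\{0,1\}$ with first letter $1$; each word is a concatenation of maximal constant nonempty subwords called blocks; $W_d(k)$ is the set of words in $W_d$ with exactly $k+1$ blocks. $G'(k,d)$ is the edge-labeled multigraph on vertex set $W_d(k)$ in which two words differing only in position $j$ are joined by an edge labeled $j$. $G(k,d)$ is obtained by adding a new vertex $\alpha$ and, for each $w\in W_d(k)$ and each $j$ with $w_j$ in a block of size one of $w$, an edge labeled $j$ from $w$ to $\alpha$. For $S\subseteq[d]$, $G_S$ denotes the spanning subgraph of $G$ consisting of all vertices and the edges with labels in $S$. -}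

module Defs where

open import Data.Bool using (Bool; true; false; if_then_else_)
open import Data.Bool.Properties using (_≟_)
open import Data.Nat using (ℕ; zero; suc; _+_)
open import Data.Fin using (Fin; toℕ)
open import Data.Fin.Subset using (Subset; _∈_)
open import Data.Vec using (Vec; []; _∷_; lookup)
open import Data.Product using (Σ; ∃; _×_; _,_)
open import Data.Empty using (⊥)
open import Data.Maybe using (Maybe; just; nothing)
open import Relation.Nullary using (¬_; yes; no)
open import Relation.Binary.PropositionalEquality using (_≡_; _≢_)
open import Relation.Binary.Construct.Closure.ReflexiveTransitive using (Star)

-- Word of length d over {0,1}: false = 0, true = 1.
Word : ℕ → Set
Word d = Vec Bool d

data Starts1 : ∀ {d} → Word d → Set where
  s1 : ∀ {d} (v : Word d) → Starts1 (true ∷ v)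

-- number of blocks (maximal constant nonempty subwords)
-- blocksFrom x v: number of blocks of the word x v (x prepended to v)
blocksFrom : ∀ {d} → Bool → Word d → ℕ
blocksFrom x [] = 1
blocksFrom x (y ∷ v) with x ≟ y
... | yes _ = blocksFrom y v
... | no _  = suc (blocksFrom y v)

blocks : ∀ {d} → Word d → ℕ
blocks [] = 0
blocks (x ∷ v) = blocksFrom x v

InW : (k d : ℕ) → Word d → Set
InW k d w = Starts1 w × blocks w ≡ suc k

Wk : ℕ → ℕ → Set
Wk k d = Σ (Word d) (InW k d)

-- vertices of G(k,d): nothing = α, just w = w ∈ W_d(k)
Vertex : ℕ → ℕ → Set
Vertex k d = Maybe (Wk k d)

DifferOnlyAt : ∀ {d} → Fin d → Word d → Word d → Set
DifferOnlyAt j w w' = lookup w j ≢ lookup w' j × (∀ i → i ≢ j → lookup w i ≡ lookup w' i)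

SingletonBlock : ∀ {d} → Word d → Fin d → Set
SingletonBlock w j =
  (∀ i → suc (toℕ i) ≡ toℕ j → lookup w i ≢ lookup w j) ×
  (∀ i → suc (toℕ j) ≡ toℕ i → lookup w i ≢ lookup w j)

Adj : (k d : ℕ) → Subset d → Vertex k d → Vertex k d → Set
Adj k d S (just (w , _)) (just (w' , _)) = ∃ λ j → j ∈ S × DifferOnlyAt j w w'
Adj k d S (just (w , _)) nothing = ∃ λ j → j ∈ S × SingletonBlock w j
Adj k d S nothing (just (w , _)) = ∃ λ j → j ∈ S × SingletonBlock w j
Adj k d S nothing nothing = ⊥

Connected : (k d : ℕ) → Subset d → Set
Connected k d S = ∀ u v → Star (Adj k d S) u v

-- Counting: a word of W_d(k) is a 1 followed by a word of length d - 1 with exactly k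
-- letter changes, and splitting on the first letter of that tail gives Pascal's rule.
--
-- Connectivity: every vertex w is joined to α. Moving the last letter of a block of
-- size at least two into the next block (or the first letter into the previous one)
-- is an edge of G'(k,d). If c lies outside the first block of w, shrink the first
-- block to size one using only labels inside it; otherwise shrink the second block to
-- size one using only labels after the first block. Either way the singleton block
-- gives an edge to α whose label is not c.

module Submission where

open import Defs
open import Data.Bool using (Bool; true; false; not)
open import Data.Bool.Properties using (_≟_; not-¬; ¬-not)
open import Data.Fin using (Fin; zero; suc; toℕ)
open import Data.Fin.Properties using (+↔⊎)
open import Data.Fin.Subset using (Subset; ∁; ⁅_⁆; _∈_)
open import Data.Fin.Subset.Properties using (x∉p⇒x∈∁p; x≢y⇒x∉⁅y⁆)
open import Data.Maybe using (Maybe; just; nothing)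
open import Data.Nat using (ℕ; zero; suc; _+_; _<_; _≤_; _∸_; z≤n; s≤s; _≤?_)
open import Data.Nat.Combinatorics using (_C_; nCk+nC[k+1]≡[n+1]C[k+1])
open import Data.Nat.Properties using (≡-irrelevant; suc-injective; <⇒≢; >⇒≢; ≤-<-trans; ≰⇒>)
open import Data.Product using (_×_; Σ; ∃; _,_)
open import Data.Sum using (_⊎_; inj₁; inj₂)
open import Data.Sum.Function.Propositional using (_⊎-↔_)
open import Data.Unit using (⊤; tt)
open import Data.Vec using ([]; _∷_; lookup)
open import Function using (_∘_)
open import Function.Bundles using (_↔_; mk↔ₛ′; Inverse)
open import Function.Properties.Inverse using (↔-refl; ↔-sym; ↔-trans)
import Function.Related.Propositional as Related
open import Relation.Binary.Construct.Closure.ReflexiveTransitive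
  using (Star; ε; _◅_; _◅◅_; gmap; reverse)
open import Relation.Binary.PropositionalEquality
  using (_≡_; _≢_; refl; sym; trans; cong; subst; ≢-sym)
open import Relation.Nullary using (yes; no; contradiction)

private
  variable
    n : ℕ

Tail : Bool → ℕ → ℕ → Set
Tail b n k = Σ (Word n) λ v → blocksFrom b v ≡ suc k

Tail-≡ : ∀ {b k} {v : Word n} (p q : blocksFrom b v ≡ suc k) →
         _≡_ {A = Tail b n k} (v , p) (v , q)
Tail-≡ p q = cong (_ ,_) (≡-irrelevant p q)

blocksFrom≢0 : ∀ b (v : Word n) → blocksFrom b v ≢ 0
blocksFrom≢0 b [] ()
blocksFrom≢0 b (y ∷ v) with b ≟ y
... | yes _ = blocksFrom≢0 y v
... | no _  = λ ()

Tail-suc-zero↔ : ∀ b n → Tail b (suc n) 0 ↔ Tail b n 0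
Tail-suc-zero↔ b n = mk↔ₛ′ (to b) (from b) (to-from b) (from-to b)
  where
  to : ∀ b → Tail b (suc n) 0 → Tail b n 0
  to true  (true  ∷ v , e) = v , e
  to false (false ∷ v , e) = v , e
  to true  (false ∷ v , e) with () ← blocksFrom≢0 false v (suc-injective e)
  to false (true  ∷ v , e) with () ← blocksFrom≢0 true v (suc-injective e)
  from : ∀ b → Tail b n 0 → Tail b (suc n) 0
  from true  (v , e) = true ∷ v , e
  from false (v , e) = false ∷ v , e
  to-from : ∀ b y → to b (from b y) ≡ y
  to-from true  _ = refl
  to-from false _ = refl
  from-to : ∀ b x → from b (to b x) ≡ x
  from-to true  (true  ∷ v , e) = refl
  from-to false (false ∷ v , e) = refl
  from-to true  (false ∷ v , e) with () ← blocksFrom≢0 false v (suc-injective e)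
  from-to false (true  ∷ v , e) with () ← blocksFrom≢0 true v (suc-injective e)

Tail-suc-suc↔ : ∀ b n k → Tail b (suc n) (suc k) ↔ (Tail (not b) n k ⊎ Tail b n (suc k))
Tail-suc-suc↔ b n k = mk↔ₛ′ (to b) (from b) (to-from b) (from-to b)
  where
  to : ∀ b → Tail b (suc n) (suc k) → Tail (not b) n k ⊎ Tail b n (suc k)
  to true  (true  ∷ v , e) = inj₂ (v , e)
  to true  (false ∷ v , e) = inj₁ (v , suc-injective e)
  to false (false ∷ v , e) = inj₂ (v , e)
  to false (true  ∷ v , e) = inj₁ (v , suc-injective e)
  from : ∀ b → Tail (not b) n k ⊎ Tail b n (suc k) → Tail b (suc n) (suc k)
  from true  (inj₁ (v , e)) = false ∷ v , cong suc e
  from true  (inj₂ (v , e)) = true ∷ v , e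
  from false (inj₁ (v , e)) = true ∷ v , cong suc e
  from false (inj₂ (v , e)) = false ∷ v , e
  to-from : ∀ b y → to b (from b y) ≡ y
  to-from true  (inj₁ _) = cong inj₁ (Tail-≡ _ _)
  to-from true  (inj₂ _) = refl
  to-from false (inj₁ _) = cong inj₁ (Tail-≡ _ _)
  to-from false (inj₂ _) = refl
  from-to : ∀ b x → from b (to b x) ≡ x
  from-to true  (true  ∷ v , e) = refl
  from-to true  (false ∷ v , e) = Tail-≡ _ _
  from-to false (false ∷ v , e) = refl
  from-to false (true  ∷ v , e) = Tail-≡ _ _

Fin-cong : ∀ {m n} → m ≡ n → Fin m ↔ Fin n
Fin-cong refl = ↔-refl

Tail↔Fin : ∀ b n k → Tail b n k ↔ Fin (n C k)
Tail↔Fin b zero zero =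
  mk↔ₛ′ (λ _ → zero) (λ _ → [] , refl) (λ { zero → refl }) (λ { ([] , _) → Tail-≡ _ _ })
Tail↔Fin b zero (suc k) = mk↔ₛ′ (λ { ([] , ()) }) (λ ()) (λ ()) (λ { ([] , ()) })
Tail↔Fin b (suc n) zero = ↔-trans (Tail-suc-zero↔ b n) (Tail↔Fin b n zero)
Tail↔Fin b (suc n) (suc k) = begin
  Tail b (suc n) (suc k)                  ↔⟨ Tail-suc-suc↔ b n k ⟩
  (Tail (not b) n k ⊎ Tail b n (suc k))   ↔⟨ Tail↔Fin (not b) n k ⊎-↔ Tail↔Fin b n (suc k) ⟩
  (Fin (n C k) ⊎ Fin (n C suc k))         ↔⟨ ↔-sym +↔⊎ ⟩
  Fin (n C k + n C suc k)                 ↔⟨ Fin-cong (nCk+nC[k+1]≡[n+1]C[k+1] n k) ⟩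
  Fin (suc n C suc k)                     ∎
  where open Related.EquationalReasoning

Wk↔Tail : ∀ k d → Wk k (suc d) ↔ Tail true d k
Wk↔Tail k d = mk↔ₛ′ to from (λ _ → refl) from-to
  where
  to : Wk k (suc d) → Tail true d k
  to (_ , s1 v , e) = v , e
  from : Tail true d k → Wk k (suc d)
  from (v , e) = true ∷ v , s1 v , e
  from-to : ∀ x → from (to x) ≡ x
  from-to (_ , s1 v , e) = refl

Maybe↔Fin-suc : ∀ {A : Set} {m} → A ↔ Fin m → Maybe A ↔ Fin (suc m)
Maybe↔Fin-suc {A} {m} A↔Fin = mk↔ₛ′ to from to-from from-to
  where
  open Inverse A↔Fin renaming (to to f; from to g)
  to : Maybe A → Fin (suc m)
  to nothing  = zero
  to (just a) = suc (f a)
  from : Fin (suc m) → Maybe A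
  from zero    = nothing
  from (suc i) = just (g i)
  to-from : ∀ y → to (from y) ≡ y
  to-from zero    = refl
  to-from (suc i) = cong suc (strictlyInverseˡ i)
  from-to : ∀ x → from (to x) ≡ x
  from-to nothing  = refl
  from-to (just a) = cong just (strictlyInverseʳ a)

vertices↔ : ∀ k d → Vertex k (suc d) ↔ Fin (suc (d C k))
vertices↔ k d = Maybe↔Fin-suc (↔-trans (Wk↔Tail k d) (Tail↔Fin true d k))

SameHead : Word n → Word n → Set
SameHead []      []       = ⊤
SameHead (x ∷ _) (y ∷ _) = x ≡ y

SameHead-sym : {v v' : Word n} → SameHead v v' → SameHead v' v
SameHead-sym {v = []}    {[]}    _ = tt
SameHead-sym {v = _ ∷ _} {_ ∷ _} e = sym e

-- An edge of G'(k,d) with label in P; keeping the head and the number of blocks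
-- makes it stay inside W_d(k) after any letter is prepended.
Flip : (Fin n → Set) → Word n → Word n → Set
Flip P v v' = (∃ λ j → P j × DifferOnlyAt j v v') × SameHead v v' × blocks v ≡ blocks v'

-- v is joined by flips to a word with a singleton block at a label in P; the letter x
-- is the one in front of v, which must not extend that block if it sits at position 0.
Escape : Bool → (Fin n → Set) → Word n → Set
Escape x P v = ∃ λ v' → Star (Flip P) v v' ×
  ∃ λ j → P j × SingletonBlock v' j × (toℕ j ≡ 0 → x ≢ lookup v' j)

DifferOnlyAt-sym : ∀ {j} {v v' : Word n} → DifferOnlyAt j v v' → DifferOnlyAt j v' v
DifferOnlyAt-sym (v≢v' , v≡v') = ≢-sym v≢v' , λ i i≢j → sym (v≡v' i i≢j)

DifferOnlyAt-∷ : ∀ x {j} {v v' : Word n} → DifferOnlyAt j v v' → DifferOnlyAt (suc j) (x ∷ v) (x ∷ v')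
DifferOnlyAt-∷ x (v≢v' , v≡v') = v≢v' , λ where
  zero    _    → refl
  (suc i) i≢j → v≡v' i (i≢j ∘ cong suc)

DifferOnlyAt-head : ∀ {a b} (v : Word n) → a ≢ b → DifferOnlyAt zero (a ∷ v) (b ∷ v)
DifferOnlyAt-head v a≢b = a≢b , λ where
  zero    0≢0 → contradiction refl 0≢0
  (suc i) _   → refl

blocksFrom-cong : ∀ x {v v' : Word n} → SameHead v v' → blocks v ≡ blocks v' →
                  blocksFrom x v ≡ blocksFrom x v'
blocksFrom-cong x {[]}    {[]}     _    _ = refl
blocksFrom-cong x {y ∷ _} {.y ∷ _} refl e with x ≟ y
... | yes _ = e
... | no _  = cong suc e

Flip-sym : ∀ {P : Fin n → Set} {v v'} → Flip P v v' → Flip P v' v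
Flip-sym {v = v} {v'} ((j , p , d) , h , e) = (j , p , DifferOnlyAt-sym {v = v} {v'} d) , SameHead-sym h , sym e

Flip-∷ : ∀ {P : Fin (suc n) → Set} x {v v'} → Flip (P ∘ suc) v v' → Flip P (x ∷ v) (x ∷ v')
Flip-∷ x ((j , p , d) , h , e) = (suc j , p , DifferOnlyAt-∷ x d) , refl , blocksFrom-cong x h e

shift-boundary : ∀ {P : Fin (suc (suc (suc n))) → Set} b (z : Word n) → P (suc zero) →
                 Flip P (b ∷ b ∷ not b ∷ z) (b ∷ not b ∷ not b ∷ z)
shift-boundary true  z p = (suc zero , p , DifferOnlyAt-∷ true (DifferOnlyAt-head _ λ ())) , refl , refl
shift-boundary false z p = (suc zero , p , DifferOnlyAt-∷ false (DifferOnlyAt-head _ λ ())) , refl , refl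

SingletonBlock-∷ : ∀ x (v : Word n) j → SingletonBlock v j → (toℕ j ≡ 0 → x ≢ lookup v j) →
                   SingletonBlock (x ∷ v) (suc j)
SingletonBlock-∷ x v j (left , right) x≢vj = left′ , right′
  where
  left′ : ∀ i → suc (toℕ i) ≡ suc (toℕ j) → lookup (x ∷ v) i ≢ lookup v j
  left′ zero    e = x≢vj (sym (suc-injective e))
  left′ (suc i) e = left i (suc-injective e)
  right′ : ∀ i → suc (suc (toℕ j)) ≡ toℕ i → lookup (x ∷ v) i ≢ lookup v j
  right′ (suc i) e = right i (suc-injective e)

SingletonBlock-head : ∀ a b (v : Word n) → a ≢ b → SingletonBlock (a ∷ b ∷ v) zero
SingletonBlock-head a b v a≢b = (λ _ ()) , λ where
  (suc zero) _ → ≢-sym a≢b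

SingletonBlock-[_] : ∀ a → SingletonBlock (a ∷ []) zero
SingletonBlock-[ a ] = (λ _ ()) , λ { zero () }

Escape-∷ : ∀ {P : Fin (suc n) → Set} x y (v : Word n) → Escape x (P ∘ suc) v → Escape y P (x ∷ v)
Escape-∷ x y v (v' , path , j , p , s , x≢) =
  x ∷ v' , gmap (x ∷_) (Flip-∷ x) path , suc j , p , SingletonBlock-∷ x v' j s x≢ , λ ()

Escape-◅ : ∀ {x} {P : Fin n → Set} {v v'} → Flip P v v' → Escape x P v' → Escape x P v
Escape-◅ f (v'' , path , rest) = v'' , f ◅ path , rest

runLength : Bool → Word n → ℕ
runLength b []      = 0
runLength b (y ∷ u) with b ≟ y
... | yes _ = suc (runLength b u)
... | no _  = 0

flipRun : Bool → Word n → Word n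
flipRun b []      = []
flipRun b (y ∷ u) with b ≟ y
... | yes _ = not b ∷ flipRun b u
... | no _  = y ∷ u

flipRun-∷ : ∀ b y (u : Word n) → ∃ λ z → flipRun b (y ∷ u) ≡ not b ∷ z
flipRun-∷ b y u with b ≟ y
... | yes _   = flipRun b u , refl
... | no b≢y = u , cong (_∷ u) (¬-not (≢-sym b≢y))

flip-last : ∀ {P : Fin (suc (suc n)) → Set} b (u : Word n) → 2 ≤ blocksFrom b u → P (suc zero) →
            Flip P (b ∷ b ∷ flipRun b u) (b ∷ not b ∷ flipRun b u)
flip-last b []      (s≤s ()) _
flip-last b (y ∷ u) _        p with flipRun-∷ b y u
... | z , eq rewrite eq = shift-boundary b z p

shrink-first-block : ∀ {P : Fin (suc n) → Set} b (u : Word n) → 2 ≤ blocksFrom b u →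
                     (∀ j → toℕ j ≤ runLength b u → P j) → Star (Flip P) (b ∷ u) (b ∷ flipRun b u)
shrink-first-block b []      (s≤s ()) _
shrink-first-block b (y ∷ u) 2≤bl allowed with b ≟ y
... | no _     = ε
... | yes refl =
  gmap (b ∷_) (Flip-∷ b) (shrink-first-block b u 2≤bl λ j j≤ → allowed (suc j) (s≤s j≤))
  ◅◅ flip-last b u 2≤bl (allowed (suc zero) (s≤s z≤n)) ◅ ε

escape-via-first-block : ∀ {P : Fin (suc n) → Set} b (u : Word n) → 2 ≤ blocksFrom b u →
                         (∀ j → toℕ j ≤ runLength b u → P j) → ∀ {x} → x ≢ b → Escape x P (b ∷ u)
escape-via-first-block b []      (s≤s ()) _
escape-via-first-block b (y ∷ u) 2≤bl allowed x≢b with flipRun-∷ b y u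
... | z , eq =
  b ∷ flipRun b (y ∷ u) , shrink-first-block b (y ∷ u) 2≤bl allowed , zero , allowed zero z≤n ,
  subst (λ t → SingletonBlock (b ∷ t) zero) (sym eq) (SingletonBlock-head b (not b) z (not-¬ refl)) ,
  λ _ → x≢b

escape-at-boundary : ∀ {P : Fin (suc (suc n)) → Set} b (u : Word n) → (∀ j → P (suc j)) →
                     ∀ x → Escape x P (b ∷ not b ∷ u)
escape-at-boundary b [] allowed x =
  _ , ε , suc zero , allowed zero , SingletonBlock-∷ b _ zero SingletonBlock-[ not b ] (λ _ → not-¬ refl) , λ ()
escape-at-boundary b (y ∷ u) allowed x with b ≟ y
... | yes refl =
  _ , ε , suc zero , allowed zero ,
  SingletonBlock-∷ b _ zero (SingletonBlock-head (not b) b u (≢-sym (not-¬ refl))) (λ _ → not-¬ refl) , λ ()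
... | no b≢y rewrite ¬-not (≢-sym b≢y) =
  -- the second block has length at least two: move its first letter into the first block
  Escape-◅ (Flip-sym (shift-boundary b u (allowed zero)))
    (Escape-∷ b x (b ∷ not b ∷ u) (escape-at-boundary b u (allowed ∘ suc) b))

escape-via-second-block : ∀ {P : Fin (suc n) → Set} b (u : Word n) → 2 ≤ blocksFrom b u →
                          (∀ j → runLength b u < toℕ j → P j) → ∀ x → Escape x P (b ∷ u)
escape-via-second-block b []      (s≤s ()) _
escape-via-second-block b (y ∷ u) 2≤bl allowed x with b ≟ y
... | yes refl =
  Escape-∷ b x (b ∷ u) (escape-via-second-block b u 2≤bl (λ j rl<j → allowed (suc j) (s≤s rl<j)) b)
... | no b≢y rewrite ¬-not (≢-sym b≢y) =
  escape-at-boundary b u (λ j → allowed (suc j) (s≤s z≤n)) x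

≢⇒∈∁⁅⁆ : ∀ {j c : Fin n} → toℕ j ≢ toℕ c → j ∈ ∁ ⁅ c ⁆
≢⇒∈∁⁅⁆ j≢c = x∉p⇒x∈∁p (x≢y⇒x∉⁅y⁆ (j≢c ∘ cong toℕ))

escape-avoiding : ∀ (c : Fin (suc n)) b (v : Word n) → 2 ≤ blocksFrom b v →
                  Escape (not b) (_∈ ∁ ⁅ c ⁆) (b ∷ v)
escape-avoiding c b v 2≤bl with toℕ c ≤? runLength b v
... | yes c≤rl = escape-via-second-block b v 2≤bl
  (λ j rl<j → ≢⇒∈∁⁅⁆ (>⇒≢ (≤-<-trans c≤rl rl<j))) (not b)
... | no c≰rl  = escape-via-first-block b v 2≤bl
  (λ j j≤rl → ≢⇒∈∁⁅⁆ (<⇒≢ (≤-<-trans j≤rl (≰⇒> c≰rl)))) (≢-sym (not-¬ refl))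

InW-Flip : ∀ {k d} {P : Fin d → Set} {w w'} → Flip P w w' → InW k d w → InW k d w'
InW-Flip {w' = _ ∷ v'} (_ , refl , e) (s1 _ , blocks≡) = s1 v' , trans (sym e) blocks≡

Escape⇒path-to-α : ∀ {k d x} {S : Subset d} (w : Word d) (w∈ : InW k d w) →
                   Escape x (_∈ S) w → Star (Adj k d S) (just (w , w∈)) nothing
Escape⇒path-to-α {k} {d} {S = S} w w∈ (v' , path , j , j∈S , singleton , _) = go w w∈ path
  where
  go : ∀ w (w∈ : InW k d w) → Star (Flip (_∈ S)) w v' → Star (Adj k d S) (just (w , w∈)) nothing
  go w w∈ ε                     = (j , j∈S , singleton) ◅ ε
  go w w∈ (f@(edge , _) ◅ rest) = edge ◅ go _ (InW-Flip f w∈) rest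

Adj-sym : ∀ {k d S} {u v : Vertex k d} → Adj k d S u v → Adj k d S v u
Adj-sym {u = just (u , _)} {just (v , _)} (j , j∈S , d) = j , j∈S , DifferOnlyAt-sym {v = u} {v} d
Adj-sym {u = just _}       {nothing}      a = a
Adj-sym {u = nothing}      {just _}       a = a

connected-via-α : ∀ {k d S} → (∀ w → Star (Adj k d S) (just w) nothing) → Connected k d S
connected-via-α to-α nothing  nothing  = ε
connected-via-α to-α (just u) nothing  = to-α u
connected-via-α to-α nothing  (just w) = reverse Adj-sym (to-α w)
connected-via-α to-α (just u) (just w) = to-α u ◅◅ reverse Adj-sym (to-α w)

lemma4p12 : (k d : ℕ) → 0 < k → k < d →
    (Vertex k d ↔ Fin (suc ((d ∸ 1) C k))) ×
    (∀ (c : Fin d) → Connected k d (∁ ⁅ c ⁆))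
lemma4p12 k zero    _   ()
lemma4p12 k (suc d) 0<k _ = vertices↔ k d , λ c → connected-via-α λ where
  (true ∷ v , w∈@(s1 v , blocks≡)) →
    Escape⇒path-to-α (true ∷ v) w∈ (escape-avoiding c true v (subst (2 ≤_) (sym blocks≡) (s≤s 0<k)))
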